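{- Let $P$ be a normal logic program and $(\mathit{Snf},\mathit{St})$ a specification such that $\mathit{St}\cup\mathit{Snf}'\models P'$. Then for each stable model $I$ of $P$, if $\mathit{Snf}\subseteq I$ then $I\subseteq\mathit{St}$.
   Context: $\mathcal{HB}$ is the Herbrand base; a specification is a pair $(\mathit{Snf},\mathit{St})$ of subsets of $\mathcal{HB}$. For each predicate symbol $p$ (other than $=$) a new predicate symbol $p'$ is introduced. $P'$ is $P$ with $p$ replaced by $p'$ in every negative body literal of every clause; for $I\subseteq\mathcal{HB}$, $I'$ is $I$ with every $p$ replaced by $p'$. $\models$ is two-valued consequence (clauses universally closed). A stable model of $P$ is an $I\subseteq\mathcal{HB}$ equal to the least Herbrand model of the Gelfond–Lifschitz reduct $\{H\gets \mathrm{pos}(B) \mid H\gets B \text{ a ground instance of a clause of } P,\ I\models \mathrm{neg}(B)\}$, where $\mathrm{pos}(B)$, $\mathrm{neg}(B)$ are the positive and negative literals of $B$. -}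

module Defs where

open import Level using (0ℓ)
open import Data.List using (List; map; [])
open import Data.List.Relation.Unary.All using (All)
open import Data.Sum using (_⊎_; inj₁; inj₂)
open import Data.Product using (_×_)
open import Relation.Nullary using (¬_)
open import Relation.Unary using (Pred; _∈_; _∉_)

-- Ground atoms over a set A (A plays the role of the Herbrand base HB).
-- A ground normal clause  H ← B  with pos(B) and neg(B) separated.
record Clause (A : Set) : Set where
  constructor _←_,_
  field
    head : A
    pos  : List A
    neg  : List A

open Clause public

-- A normal program, represented by the set of ground instances of its clauses.
Program : Set → Set₁
Program A = Pred (Clause A) 0ℓ

Interp : Set → Set₁
Interp A = Pred A 0ℓ

_⊨ᶜ_ : {A : Set} → Interp A → Clause A → Set
J ⊨ᶜ c = All (_∈ J) (pos c) → All (_∉ J) (neg c) → head c ∈ J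

_⊨_ : {A : Set} → Interp A → Program A → Set
J ⊨ P = ∀ c → c ∈ P → J ⊨ᶜ c

-- Extended Herbrand base: inj₁ a is the atom p(t), inj₂ a is p'(t).
-- c' : replace p by p' in the negative body literals.
primeᶜ : {A : Set} → Clause A → Clause (A ⊎ A)
primeᶜ (h ← ps , ns) = inj₁ h ← map inj₁ ps , map inj₂ ns

data Prime {A : Set} (P : Program A) : Program (A ⊎ A) where
  prime : ∀ c → c ∈ P → primeᶜ c ∈ Prime P

_∪′_ : {A : Set} → Interp A → Interp A → Interp (A ⊎ A)
(St ∪′ Snf) (inj₁ a) = a ∈ St
(St ∪′ Snf) (inj₂ a) = a ∈ Snf

data Reduct {A : Set} (P : Program A) (I : Interp A) : Pred (Clause A) 0ℓ where
  red : ∀ h ps ns → (h ← ps , ns) ∈ P → All (_∉ I) ns →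
        (h ← ps , []) ∈ Reduct P I

data LeastModel {A : Set} (D : Pred (Clause A) 0ℓ) : Interp A where
  derive : ∀ h ps → (h ← ps , []) ∈ D →
           All (_∈ LeastModel D) ps → h ∈ LeastModel D

StableModel : {A : Set} → Program A → Interp A → Set
StableModel P I = ∀ a → (a ∈ I → a ∈ LeastModel (Reduct P I))
                      × (a ∈ LeastModel (Reduct P I) → a ∈ I)

{-# OPTIONS --safe #-}
module Submission where

-- The hypothesis makes St a model of the reduct P^I whenever Snf ⊆ I: a negative
-- literal ¬n that holds in I also holds for n' in St ∪ Snf'.  The least model of
-- P^I, which is I itself, therefore lies inside St.

open import Defs
open import Relation.Unary using (Pred; _⊆_; _∈_; _∉_)
open import Level using (0ℓ)
open import Data.List using (List; []; _∷_)
open import Data.List.Relation.Unary.All as All using (All; []; _∷_)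
open import Data.List.Relation.Unary.All.Properties using (map⁺)
open import Data.Product using (proj₁)

module _ {A : Set} {D : Pred (Clause A) 0ℓ} {J : Interp A} (J⊨D : J ⊨ D) where

  mutual
    LeastModel⊆model : LeastModel D ⊆ J
    LeastModel⊆model (derive _ _ c∈D ps∈LM) = J⊨D _ c∈D (All-LeastModel⊆model ps∈LM) []

    All-LeastModel⊆model : {as : List A} → All (_∈ LeastModel D) as → All (_∈ J) as
    All-LeastModel⊆model []              = []
    All-LeastModel⊆model (a∈LM ∷ as∈LM) = LeastModel⊆model a∈LM ∷ All-LeastModel⊆model as∈LM

⊨Prime⇒⊨Reduct : {A : Set} {P : Program A} {Snf St I : Interp A} →
                 (St ∪′ Snf) ⊨ Prime P → Snf ⊆ I → St ⊨ Reduct P I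
⊨Prime⇒⊨Reduct ⊨P′ Snf⊆I _ (red _ _ _ c∈P ns∉I) ps∈St _ =
  ⊨P′ _ (prime _ c∈P) (map⁺ ps∈St) (map⁺ (All.map (λ n∉I n∈Snf → n∉I (Snf⊆I n∈Snf)) ns∉I))

proposition1 : {A : Set} (P : Program A) (Snf St : Interp A) →
    (St ∪′ Snf) ⊨ Prime P →
    ∀ (I : Interp A) → StableModel P I → Snf ⊆ I → I ⊆ St
proposition1 P Snf St ⊨P′ I stable Snf⊆I {a} a∈I =
  LeastModel⊆model (⊨Prime⇒⊨Reduct ⊨P′ Snf⊆I) (proj₁ (stable a) a∈I)
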